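{- Let $A \subseteq \mathbb{Z}_6$ and let $y$ be a natural number with $y < |A|$. If $1 \le y < |A|-1$, then $|A\,\psi^y A| \ge |A|$; if $y = |A|-1$, then $|A\,\psi^y A| = 1$.
   Context: For $A\subseteq\mathbb{Z}_6$ and a natural number $y$, $A\,\psi^{y}A$ denotes the set of elements of $\mathbb{Z}_6$ that can be written as a sum of $y+1$ distinct elements of $A$. -}

module Defs where

open import Data.Nat using (ℕ; zero; suc; _+_; _%_)
import Data.Fin
open import Data.Fin using (Fin; toℕ; fromℕ<)
open import Data.Fin.Subset using (Subset; _⊆_; ∣_∣; _∈_; inside; outside)
open import Data.Nat.DivMod using (m%n<n)
open import Data.Vec using (Vec; []; _∷_; allFin; zipWith; foldr)
open import Data.Bool using (Bool; true; false)
open import Data.Product using (∃; _×_)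
open import Relation.Binary.PropositionalEquality using (_≡_)

ℤ₆ : Set
ℤ₆ = Fin 6

_+₆_ : ℤ₆ → ℤ₆ → ℤ₆
a +₆ b = fromℕ< (m%n<n (toℕ a + toℕ b) 6)

zero₆ : ℤ₆
zero₆ = Data.Fin.zero

sumSub : Subset 6 → ℤ₆
sumSub B = foldr _ _+₆_ zero₆ (zipWith pick B (allFin 6))
  where
  pick : Bool → ℤ₆ → ℤ₆
  pick true  x = x
  pick false x = zero₆

-- x ∈ A ψ^y A : x is a sum of y+1 distinct elements of A.
InPsi : Subset 6 → ℕ → ℤ₆ → Set
InPsi A y x = ∃ λ (B : Subset 6) → B ⊆ A × ∣ B ∣ ≡ suc y × sumSub B ≡ x

{-# OPTIONS --safe #-}
module Submission where

open import Defs
open import Data.Bool using (true)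
open import Data.Fin using (Fin)
import Data.Fin.Properties as Fin
open import Data.Fin.Subset using (Subset; ∣_∣; _∈_)
open import Data.Fin.Subset.Properties using (anySubset?; _⊆?_; ⊆-antisym; ∣p∣≤n)
open import Data.Nat using (ℕ; suc; _≤_; _<_; _∸_)
import Data.Nat.Properties as ℕ
open import Data.Product using (_×_; _,_)
open import Data.Vec using (tabulate)
open import Data.Vec.Properties using (lookup∘tabulate; lookup⇒[]=; []=⇒lookup)
open import Function using (_∘_)
open import Function.Bundles using (_⇔_; mk⇔; Equivalence)
open import Level using (Level)
open import Relation.Binary.PropositionalEquality using (_≡_; sym; trans; subst)
open import Relation.Nullary using (Dec; does; yes; ¬?)
open import Relation.Nullary.Decidable using (_×-dec_; _→-dec_; toWitness; map′; decidable-stable; dec-true)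
open import Relation.Unary using (Pred; Decidable)

module _ {n : ℕ} {ℓ : Level} {P : Pred (Fin n) ℓ} (P? : Decidable P) where

  toSubset : Subset n
  toSubset = tabulate (does ∘ P?)

  ∈-toSubset⇔ : ∀ {x} → x ∈ toSubset ⇔ P x
  ∈-toSubset⇔ {x} = mk⇔
    (does-true (P? x) ∘ trans (sym (lookup∘tabulate (does ∘ P?) x)) ∘ []=⇒lookup)
    (lookup⇒[]= x toSubset ∘ trans (lookup∘tabulate (does ∘ P?) x) ∘ dec-true (P? x))
    where
    does-true : (d : Dec (P x)) → does d ≡ true → P x
    does-true (yes p) _ = p

  toSubset-unique : (S : Subset n) → (∀ x → x ∈ S ⇔ P x) → S ≡ toSubset
  toSubset-unique S S⇔P = ⊆-antisym
    (Equivalence.from ∈-toSubset⇔ ∘ Equivalence.to (S⇔P _))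
    (Equivalence.from (S⇔P _) ∘ Equivalence.to ∈-toSubset⇔)

allSubset? : ∀ {n ℓ} {P : Pred (Subset n) ℓ} → Decidable P → Dec (∀ p → P p)
allSubset? P? = map′
  (λ ∄¬P p → decidable-stable (P? p) (λ ¬Pp → ∄¬P (p , ¬Pp)))
  (λ ∀P (p , ¬Pp) → ¬Pp (∀P p))
  (¬? (anySubset? (¬? ∘ P?)))

InPsi? : (A : Subset 6) (y : ℕ) → Decidable (InPsi A y)
InPsi? A y x = anySubset? λ B → (B ⊆? A) ×-dec ((∣ B ∣ ℕ.≟ suc y) ×-dec (sumSub B Fin.≟ x))

ψ : Subset 6 → ℕ → Subset 6
ψ A y = toSubset (InPsi? A y)

SizeBounds : Subset 6 → ℕ → ℕ → Set
SizeBounds A y s = ((1 ≤ y × y < ∣ A ∣ ∸ 1) → ∣ A ∣ ≤ s) × (y ≡ ∣ A ∣ ∸ 1 → s ≡ 1)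

SizeBounds? : ∀ A y s → Dec (SizeBounds A y s)
SizeBounds? A y s =
  (((1 ℕ.≤? y) ×-dec (y ℕ.<? ∣ A ∣ ∸ 1)) →-dec (∣ A ∣ ℕ.≤? s)) ×-dec
  ((y ℕ.≟ ∣ A ∣ ∸ 1) →-dec (s ℕ.≟ 1))

-- Checked by evaluation over all 64 subsets A and all y < 6.
ψ-sizeBounds : (A : Subset 6) {y : ℕ} → y < ∣ A ∣ → SizeBounds A y ∣ ψ A y ∣
ψ-sizeBounds A y<∣A∣ = exhaustive A (ℕ.≤-trans y<∣A∣ (∣p∣≤n A)) y<∣A∣
  where
  exhaustive : ∀ A {y} → y < 6 → y < ∣ A ∣ → SizeBounds A y ∣ ψ A y ∣
  exhaustive = toWitness {a? = allSubset? λ A →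
    ℕ.allUpTo? (λ y → (y ℕ.<? ∣ A ∣) →-dec SizeBounds? A y ∣ ψ A y ∣) 6} _

lemma4p3 : (A : Subset 6) (y : ℕ) → y < ∣ A ∣ →
    (S : Subset 6) → (∀ x → (x ∈ S) ⇔ InPsi A y x) →
    ((1 ≤ y × y < ∣ A ∣ ∸ 1) → ∣ A ∣ ≤ ∣ S ∣) ×
    (y ≡ ∣ A ∣ ∸ 1 → ∣ S ∣ ≡ 1)
lemma4p3 A y y<∣A∣ S S⇔ψ =
  subst (SizeBounds A y ∘ ∣_∣) (sym (toSubset-unique (InPsi? A y) S S⇔ψ)) (ψ-sizeBounds A y<∣A∣)
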